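{- There exists a perfect $1$-error-correcting code in the Cartesian product $C_6 \square C_6 \square C_2$.
   Context: All graphs are simple; $d(x,y)$ is the shortest-path distance. $C_6$ is the cycle on $6$ vertices and, by convention, $C_2$ is a single edge ($K_2$). The Cartesian product $G\square H$ has vertex set $V(G)\times V(H)$, with $(g_1,h_1)$ adjacent to $(g_2,h_2)$ iff either $h_1=h_2$ and $g_1g_2\in E(G)$, or $g_1=g_2$ and $h_1h_2\in E(H)$. A code is a subset $D$ of the vertex set; it is a perfect $1$-error-correcting code if any two distinct codewords are at distance at least $3$ and every vertex is at distance at most $1$ from some codeword. -}

module Defs where

open import Level using (0ℓ)
open import Data.Nat using (ℕ; zero; suc; _+_; _≤_; _%_; NonZero)
open import Data.Fin using (Fin; toℕ)
open import Data.Product using (_×_; _,_; ∃; Σ-syntax)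
open import Data.Sum using (_⊎_)
open import Relation.Nullary using (¬_)
open import Relation.Binary.PropositionalEquality using (_≡_)

record Graph : Set₁ where
  field
    V     : Set
    Adj   : V → V → Set
    irrefl : ∀ {x} → ¬ Adj x x
    sym   : ∀ {x y} → Adj x y → Adj y x
open Graph public

data Walk (G : Graph) : V G → V G → ℕ → Set where
  here : ∀ {x} → Walk G x x zero
  step : ∀ {x y z k} → Adj G x y → Walk G y z k → Walk G x z (suc k)

DistLE : (G : Graph) → ℕ → V G → V G → Set
DistLE G k x y = ∃ λ m → m ≤ k × Walk G x y m

-- The cycle C_n on vertices Fin n: i ~ j iff j ≡ i+1 (mod n) or i ≡ j+1 (mod n).
-- For n = 2 this is the single edge K₂ (the stated convention).
CycAdj : (n : ℕ) → .{{NonZero n}} → Fin n → Fin n → Set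
CycAdj n i j = (¬ i ≡ j) × ((toℕ j ≡ (toℕ i + 1) % n) ⊎ (toℕ i ≡ (toℕ j + 1) % n))

Cycle : (n : ℕ) → .{{_ : NonZero n}} → Graph
Cycle n = record
  { V = Fin n
  ; Adj = CycAdj n
  ; irrefl = λ { (ne , _) → ne _≡_.refl }
  ; sym = λ { (ne , Data.Sum.inj₁ e) → (λ q → ne (symm q)) , Data.Sum.inj₂ e
            ; (ne , Data.Sum.inj₂ e) → (λ q → ne (symm q)) , Data.Sum.inj₁ e }
  }
  where
  open import Relation.Binary.PropositionalEquality using () renaming (sym to symm)
  import Data.Sum

_□_ : Graph → Graph → Graph
G □ H = record
  { V = V G × V H
  ; Adj = λ { (g₁ , h₁) (g₂ , h₂) → (h₁ ≡ h₂ × Adj G g₁ g₂) ⊎ (g₁ ≡ g₂ × Adj H h₁ h₂) }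
  ; irrefl = λ { (inj₁ (_ , a)) → irrefl G a ; (inj₂ (_ , a)) → irrefl H a }
  ; sym = λ { (inj₁ (e , a)) → inj₁ (symm e , Graph.sym G a)
            ; (inj₂ (e , a)) → inj₂ (symm e , Graph.sym H a) }
  }
  where
  open import Data.Sum using (inj₁; inj₂)
  open import Relation.Binary.PropositionalEquality using () renaming (sym to symm)
infixr 6 _□_

IsPerfectCode : (G : Graph) → (V G → Set) → Set
IsPerfectCode G D =
  (∀ c c' → D c → D c' → ¬ c ≡ c' → ¬ DistLE G 2 c c')
  × (∀ v → ∃ λ c → D c × DistLE G 1 v c)

-- The vertex set is the group ℤ₆ × ℤ₆ × ℤ₂, and the closed neighbourhood of 0 is
-- S = {0, ±e₁, ±e₂, e₃}. The homomorphism σ(a, b, c) = (a + c mod 2, a + b mod 3) onto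
-- ℤ₂ × ℤ₃ sends the six elements of S to six distinct values, so every coset of ker σ
-- meets every translate of S exactly once; the coset σ⁻¹(0, 1) is therefore a perfect code.
module Submission where

open import Defs
open import Level using (0ℓ)
open import Data.Nat as ℕ using (ℕ; NonZero; _+_; _%_; z≤n; s≤s)
open import Data.Fin as Fin using (toℕ)
open import Data.Fin.Properties using (all?; any?)
open import Data.Product using (∃; _×_; _,_)
open import Data.Product.Properties using (≡-dec)
open import Data.Sum using (_⊎_; inj₁; inj₂)
open import Relation.Nullary using (¬_; Dec; ¬?)
open import Relation.Nullary.Decidable using (map′; _×-dec_; _⊎-dec_; _→-dec_; from-yes)
open import Relation.Unary as U using (Pred)
open import Relation.Binary using (Decidable; DecidableEquality)
open import Relation.Binary.PropositionalEquality using (_≡_; refl)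

module _ (G : Graph) where

  Ball₁ : V G → V G → Set
  Ball₁ x y = x ≡ y ⊎ Adj G x y

  Covering : (V G → Set) → Set
  Covering D = ∀ v → ∃ λ c → D c × Ball₁ v c

  Packing : (V G → Set) → Set
  Packing D = ∀ z c → D c → Ball₁ z c → ∀ c' → D c' → Ball₁ z c' → c ≡ c'

  ball₁⇒dist≤1 : ∀ {x y} → Ball₁ x y → DistLE G 1 x y
  ball₁⇒dist≤1 (inj₁ refl) = 0 , z≤n , here
  ball₁⇒dist≤1 (inj₂ x~y) = 1 , s≤s z≤n , step x~y here

  dist≤2⇒common-ball₁ : ∀ {x y} → DistLE G 2 x y → ∃ λ z → Ball₁ z x × Ball₁ z y
  dist≤2⇒common-ball₁ {x} (_ , _ , here) = x , inj₁ refl , inj₁ refl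
  dist≤2⇒common-ball₁ {x} (_ , _ , step x~y here) = x , inj₁ refl , inj₂ x~y
  dist≤2⇒common-ball₁ (_ , _ , step {y = z} x~z (step z~y here)) =
    z , inj₂ (Graph.sym G x~z) , inj₂ z~y
  dist≤2⇒common-ball₁ (_ , s≤s (s≤s ()) , step _ (step _ (step _ _)))

  covering∧packing⇒isPerfectCode : ∀ {D} → Covering D → Packing D → IsPerfectCode G D
  covering∧packing⇒isPerfectCode {D} covering packing = separated , covered
    where
    separated : ∀ c c' → D c → D c' → ¬ c ≡ c' → ¬ DistLE G 2 c c'
    separated c c' Dc Dc' c≢c' c~c' with dist≤2⇒common-ball₁ c~c'
    ... | z , z∋c , z∋c' = c≢c' (packing z c Dc z∋c c' Dc' z∋c')
    covered : ∀ v → ∃ λ c → D c × DistLE G 1 v c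
    covered v with covering v
    ... | c , Dc , v∈B = c , Dc , ball₁⇒dist≤1 v∈B

record DecidableGraph (G : Graph) : Set where
  field
    _≟_  : DecidableEquality (V G)
    adj? : Decidable (Adj G)

  ball₁? : Decidable (Ball₁ G)
  ball₁? x y = x ≟ y ⊎-dec adj? x y

cycle-decidable : (n : ℕ) → .{{_ : NonZero n}} → DecidableGraph (Cycle n)
cycle-decidable n = record
  { _≟_  = Fin._≟_
  ; adj? = λ i j → ¬? (i Fin.≟ j)
                   ×-dec (toℕ j ℕ.≟ (toℕ i + 1) % n ⊎-dec toℕ i ℕ.≟ (toℕ j + 1) % n)
  }

□-decidable : ∀ {G H} → DecidableGraph G → DecidableGraph H → DecidableGraph (G □ H)
□-decidable G? H? = record
  { _≟_  = ≡-dec G._≟_ H._≟_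
  ; adj? = λ { (g₁ , h₁) (g₂ , h₂) → (h₁ H.≟ h₂ ×-dec G.adj? g₁ g₂)
                                    ⊎-dec (g₁ G.≟ g₂ ×-dec H.adj? h₁ h₂) }
  }
  where
  module G = DecidableGraph G?
  module H = DecidableGraph H?

Exhaustible : Set → Set₁
Exhaustible A = ∀ {P : Pred A 0ℓ} → U.Decidable P → Dec (∀ x → P x)

Searchable : Set → Set₁
Searchable A = ∀ {P : Pred A 0ℓ} → U.Decidable P → Dec (∃ P)

×-exhaustible : ∀ {A B} → Exhaustible A → Exhaustible B → Exhaustible (A × B)
×-exhaustible ∀A? ∀B? P? =
  map′ (λ h (a , b) → h a b) (λ h a b → h (a , b)) (∀A? λ a → ∀B? λ b → P? (a , b))

×-searchable : ∀ {A B} → Searchable A → Searchable B → Searchable (A × B)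
×-searchable ∃A? ∃B? P? =
  map′ (λ (a , b , p) → (a , b) , p) (λ ((a , b) , p) → a , b , p)
       (∃A? λ a → ∃B? λ b → P? (a , b))

C₆□C₆□C₂ : Graph
C₆□C₆□C₂ = Cycle 6 □ Cycle 6 □ Cycle 2

Vertex : Set
Vertex = V C₆□C₆□C₂

decidable : DecidableGraph C₆□C₆□C₂
decidable = □-decidable (cycle-decidable 6) (□-decidable (cycle-decidable 6) (cycle-decidable 2))

open DecidableGraph decidable using (_≟_; ball₁?)

all-vertices? : Exhaustible Vertex
all-vertices? = ×-exhaustible all? (×-exhaustible all? all?)

any-vertex? : Searchable Vertex
any-vertex? = ×-searchable any? (×-searchable any? any?)

-- The coset σ⁻¹(0, 1) of the header.
Code : Vertex → Set
Code (a , b , c) = toℕ a % 2 ≡ toℕ c × (toℕ a + toℕ b) % 3 ≡ 1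

code? : U.Decidable Code
code? (a , b , c) = toℕ a % 2 ℕ.≟ toℕ c ×-dec (toℕ a + toℕ b) % 3 ℕ.≟ 1

code-covering : Covering C₆□C₆□C₂ Code
code-covering = from-yes (all-vertices? λ v → any-vertex? λ c → code? c ×-dec ball₁? v c)

-- `does (p →-dec q)` is `not (does p) ∨ does q`, so the innermost search runs only for
-- the codewords in each ball and the check stays linear in |V|².
code-packing : Packing C₆□C₆□C₂ Code
code-packing = from-yes
  (all-vertices? λ z → all-vertices? λ c → code? c →-dec ball₁? z c →-dec
   all-vertices? λ c' → code? c' →-dec ball₁? z c' →-dec c ≟ c')

theorem9 : ∃ λ (D : V (Cycle 6 □ Cycle 6 □ Cycle 2) → Set) → IsPerfectCode (Cycle 6 □ Cycle 6 □ Cycle 2) D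
theorem9 = Code , covering∧packing⇒isPerfectCode C₆□C₆□C₂ code-covering code-packing
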